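{- Let $f\in\mathbb{F}[x_1,\dots,x_n]$ be computed by a $k$-pass ABP of width $w$ according to the order $\pi$. Then $f$ can be computed by a read-once oblivious ABP of width $w^{2k}$ that reads the variables in the order $x_{\pi(1)},\dots,x_{\pi(n)}$.
   Context: An algebraic branching program (ABP) over $\mathbb{F}$ is a directed acyclic graph whose vertices are partitioned into layers $0,\dots,L$, with a single source in layer $0$ and a single sink in layer $L$, edges only from layer $\ell-1$ to layer $\ell$, each edge labeled by a polynomial; it computes the sum over all source–sink paths of the product of edge labels. Its width is the maximum number of vertices in a layer. It is oblivious if in each layer all edge labels are univariate polynomials in one common variable (the variable read by the layer); it is read-once oblivious if each variable is read in at most one layer. It is a $k$-pass ABP according to the order $\pi$ (a permutation of $[n]$) if its layers read the variables in the order $x_{\pi(1)},\dots,x_{\pi(n)}$ repeated $k$ times. -}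

module Defs where

open import Level using (Level; _⊔_)
open import Algebra.Bundles using (CommutativeRing)
open import Data.Nat as ℕ using (ℕ; zero; suc; _≤_)
open import Data.Fin using (Fin; zero; suc)
open import Data.Fin.Permutation using (Permutation′; _⟨$⟩ʳ_)
open import Data.List using (List; []; _∷_; map; concat; replicate; allFin)
open import Data.Product using (_×_; ∃)
open import Data.Unit.Polymorphic using (⊤)
open import Relation.Nullary using (¬_)

record Field (c ℓ : Level) : Set (Level.suc (c ⊔ ℓ)) where
  field
    commutativeRing : CommutativeRing c ℓ
  open CommutativeRing commutativeRing public
  field
    0≉1     : ¬ (0# ≈ 1#)
    inverse : ∀ x → ¬ (x ≈ 0#) → ∃ λ y → (x * y) ≈ 1#

module ABPs {c ℓ : Level} (R : CommutativeRing c ℓ) where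
  open CommutativeRing R using (_≈_; _+_; _*_; 0#; 1#) renaming (Carrier to K)

  -- Univariate polynomials: coefficient lists c₀ ∷ c₁ ∷ …  (c₀ + c₁ t + …).
  UPoly : Set c
  UPoly = List K

  -- Formal polynomials in n variables x₀,…,x_{n-1}, in recursive (Horner)
  -- form: a polynomial in suc n variables is a list of coefficients, each
  -- a polynomial in n variables; the list index is the exponent of the
  -- variable x₀ (Fin.zero), and the remaining variables x₁,… are the
  -- variables of the coefficients.
  data Poly : ℕ → Set c where
    con : K → Poly zero
    hor : ∀ {n} → List (Poly n) → Poly (suc n)

  infix 4 _≈P_
  infixl 6 _+P_ _+L_
  infixl 7 _*P_ _*L_

  -- Equality of formal polynomials (coefficientwise; trailing zero
  -- coefficients are immaterial).
  IsZero  : ∀ {n} → Poly n → Set ℓ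
  IsZeroL : ∀ {n} → List (Poly n) → Set ℓ
  _≈P_    : ∀ {n} → Poly n → Poly n → Set ℓ
  _≈L_    : ∀ {n} → List (Poly n) → List (Poly n) → Set ℓ
  IsZero (con a)  = a ≈ 0#
  IsZero (hor ps) = IsZeroL ps
  IsZeroL []       = ⊤
  IsZeroL (p ∷ ps) = IsZero p × IsZeroL ps
  con a  ≈P con b  = a ≈ b
  hor ps ≈P hor qs = ps ≈L qs
  []       ≈L qs       = IsZeroL qs
  (p ∷ ps) ≈L []       = IsZeroL (p ∷ ps)
  (p ∷ ps) ≈L (q ∷ qs) = (p ≈P q) × (ps ≈L qs)

  constP : ∀ {n} → K → Poly n
  constP {zero}  a = con a
  constP {suc n} a = hor (constP a ∷ [])

  0P 1P : ∀ {n} → Poly n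
  0P = constP 0#
  1P = constP 1#

  _+P_ : ∀ {n} → Poly n → Poly n → Poly n
  _+L_ : ∀ {n} → List (Poly n) → List (Poly n) → List (Poly n)
  con a  +P con b  = con (a + b)
  hor ps +P hor qs = hor (ps +L qs)
  []       +L qs       = qs
  (p ∷ ps) +L []       = p ∷ ps
  (p ∷ ps) +L (q ∷ qs) = (p +P q) ∷ (ps +L qs)

  _*P_ : ∀ {n} → Poly n → Poly n → Poly n
  _*L_ : ∀ {n} → List (Poly n) → List (Poly n) → List (Poly n)
  scaleL : ∀ {n} → Poly n → List (Poly n) → List (Poly n)
  con a  *P con b  = con (a * b)
  hor ps *P hor qs = hor (ps *L qs)
  []       *L qs = []
  (p ∷ ps) *L qs = scaleL p qs +L (0P ∷ (ps *L qs))
  scaleL p []       = []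
  scaleL p (q ∷ qs) = (p *P q) ∷ scaleL p qs

  -- The univariate polynomial u(t) evaluated at t = x_i, as a formal
  -- polynomial in n variables.
  embed : ∀ {n} → Fin n → UPoly → Poly n
  embed {suc n} zero    u = hor (map constP u)
  embed {suc n} (suc i) u = hor (embed i u ∷ [])

  sumP : ∀ {n} (d : ℕ) → (Fin d → Poly n) → Poly n
  sumP zero    f = 0P
  sumP (suc d) f = f zero +P sumP d (λ b → f (suc b))

  -- An oblivious layered ABP of width ≤ w, from a layer with d vertices
  -- to the sink, whose successive edge layers read the variables listed
  -- in `vs`.  A layer reading x_i is given by the matrix of its edge
  -- labels (univariate polynomials in x_i; a missing edge = label 0).
  data Prog (n w : ℕ) : (d : ℕ) → List (Fin n) → Set c where
    sink : 1 ≤ w → Prog n w 1 []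
    layer : ∀ {d vs} (d′ : ℕ) (i : Fin n) →
            (Fin d → Fin d′ → UPoly) →
            d′ ≤ w → Prog n w d′ vs → Prog n w d (i ∷ vs)

  -- evalFrom P a = sum over all paths from vertex a (of the current
  -- layer) to the sink of the product of the edge labels.
  evalFrom : ∀ {n w d vs} → Prog n w d vs → Fin d → Poly n
  evalFrom (sink _)             zero = 1P
  evalFrom (layer d′ i M _ P)   a    =
    sumP d′ (λ b → embed i (M a b) *P evalFrom P b)

  -- An oblivious ABP of width w (every layer, including the single-vertex
  -- source and sink layers, has ≤ w vertices) reading variables in the
  -- order vs (one variable per edge layer).
  ObliviousABP : (n w : ℕ) → List (Fin n) → Set c
  ObliviousABP n w vs = Prog n w 1 vs

  output : ∀ {n w vs} → ObliviousABP n w vs → Poly n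
  output P = evalFrom P zero

  order : ∀ {n} → Permutation′ n → List (Fin n)
  order π = map (π ⟨$⟩ʳ_) (allFin _)

  KPassABP : (n k w : ℕ) → Permutation′ n → Set c
  KPassABP n k w π = ObliviousABP n w (concat (replicate k (order π)))

  -- read-once oblivious ABP of width w reading x_{π(1)},…,x_{π(n)}
  -- (each variable is read in exactly one layer, since π is a permutation).
  ROABP : (n w : ℕ) → Permutation′ n → Set c
  ROABP n w π = ObliviousABP n w (order π)

module Submission where

-- Cut after each pass, the program's value is a product S₁ ⋯ S_k of
-- transfer matrices of segments reading vs = x_{π(1)} … x_{π(n)} once.
-- Tensoring segments that read the same variables multiplies transfer
-- matrices entrywise, so the passes are absorbed one at a time into one
-- segment (identity ⊗ S₁) ⊗ T, where T represents the remaining passes and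
-- the identity factor carries a guessed start vertex of T across S₁; each
-- pass costs a factor w·w of width.  Finally the sources and sinks are
-- merged by summing rows of the first and columns of the last layer.

open import Defs
open import Level using (Level; _⊔_)
open import Algebra.Bundles using (CommutativeRing; CommutativeSemiring; CommutativeMonoid)
open import Algebra.Core using (Op₂)
open import Algebra.Definitions using (Congruent₂; Associative)
open import Algebra.Structures using (IsCommutativeSemiring; IsCommutativeMonoid; IsSemigroup)
open import Algebra.Structures.Biased using (isCommutativeSemiringˡ; isCommutativeMonoidˡ)
open import Algebra.Morphism.Structures using (module MonoidMorphisms)
import Algebra.Morphism.MonoidMonomorphism as MonoidMonomorphism
import Algebra.Construct.Pointwise as Pointwise
open import Data.Bool using (Bool; true; false)
open import Data.Nat using (ℕ; zero; suc; _≤_; _+_; _*_; _^_; >-nonZero)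
import Data.Nat.Properties as ℕₚ
open import Data.Fin using (Fin; zero; suc; combine; remQuot; quotient; remainder; _↑ˡ_; _↑ʳ_)
open import Data.Fin.Properties using (_≟_; combine-injectiveˡ; combine-injectiveʳ; remQuot-combine)
open import Data.Fin.Permutation using (Permutation′; _⟨$⟩ʳ_)
open import Data.List using (List; []; _∷_; map; _++_; concat; replicate)
open import Data.Product using (Σ; _,_; proj₁; proj₂; uncurry; map₂)
open import Data.Unit.Polymorphic using (tt)
open import Function using (_∘_)
open import Relation.Binary.Structures using (IsEquivalence)
import Relation.Binary.PropositionalEquality as ≡
open ≡ using (_≡_; _≢_)
open import Relation.Nullary using (does; yes; no)
open import Relation.Nullary.Decidable using (dec-true; dec-false)

module PolynomialSemiring {c ℓ : Level} (R : CommutativeRing c ℓ) where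
  open ABPs R
  private module K = CommutativeRing R

  -- _≈P_ packaged as a record, so that the two polynomials it relates
  -- can always be recovered by unification.
  infix 4 _≃_
  record _≃_ {n : ℕ} (p q : Poly n) : Set ℓ where
    constructor ⟨_⟩
    field unwrap : p ≈P q
  open _≃_ public

  record SemiringLaws (n : ℕ) : Set (c ⊔ ℓ) where
    field
      isCommutativeSemiring : IsCommutativeSemiring (_≃_ {n}) _+P_ _*P_ 0P 1P
      isZero⇒≃0 : {p : Poly n} → IsZero p → p ≃ 0P
      ≃0⇒isZero : {p : Poly n} → p ≃ 0P → IsZero p

    commutativeSemiring : CommutativeSemiring c ℓ
    commutativeSemiring = record { isCommutativeSemiring = isCommutativeSemiring }

  laws₀ : SemiringLaws 0
  laws₀ = record
    { isCommutativeSemiring = isCommutativeSemiringˡ (record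
        { +-isCommutativeMonoid = isCommutativeMonoidˡ (record
            { isSemigroup = semigroup₀ _+P_
                (λ { {con _} {con _} {con _} {con _} ⟨ e ⟩ ⟨ f ⟩ → ⟨ K.+-cong e f ⟩ })
                (λ { (con a) (con b) (con d) → ⟨ K.+-assoc a b d ⟩ })
            ; identityˡ = λ { (con a) → ⟨ K.+-identityˡ a ⟩ }
            ; comm      = λ { (con a) (con b) → ⟨ K.+-comm a b ⟩ } })
        ; *-isCommutativeMonoid = isCommutativeMonoidˡ (record
            { isSemigroup = semigroup₀ _*P_
                (λ { {con _} {con _} {con _} {con _} ⟨ e ⟩ ⟨ f ⟩ → ⟨ K.*-cong e f ⟩ })
                (λ { (con a) (con b) (con d) → ⟨ K.*-assoc a b d ⟩ })
            ; identityˡ = λ { (con a) → ⟨ K.*-identityˡ a ⟩ }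
            ; comm      = λ { (con a) (con b) → ⟨ K.*-comm a b ⟩ } })
        ; distribʳ = λ { (con a) (con b) (con d) → ⟨ K.distribʳ a b d ⟩ }
        ; zeroˡ    = λ { (con a) → ⟨ K.zeroˡ a ⟩ } })
    ; isZero⇒≃0 = λ { {con _} z → ⟨ z ⟩ }
    ; ≃0⇒isZero = λ { {con _} ⟨ z ⟩ → z } }
    where
    ≃₀-isEquivalence : IsEquivalence (_≃_ {0})
    ≃₀-isEquivalence = record
      { refl  = λ { {con _} → ⟨ K.refl ⟩ }
      ; sym   = λ { {con _} {con _} ⟨ e ⟩ → ⟨ K.sym e ⟩ }
      ; trans = λ { {con _} {con _} {con _} ⟨ e ⟩ ⟨ f ⟩ → ⟨ K.trans e f ⟩ } }
    semigroup₀ : (_∙_ : Op₂ (Poly 0)) → Congruent₂ _≃_ _∙_ → Associative _≃_ _∙_ →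
                 IsSemigroup _≃_ _∙_
    semigroup₀ _ cong assoc = record
      { isMagma = record { isEquivalence = ≃₀-isEquivalence ; ∙-cong = cong } ; assoc = assoc }

  -- Lists of coefficients are compared coefficientwise; additive
  -- laws are inherited from sequences ℕ → Poly n, multiplicative laws are
  -- proved by induction on lists.
  module Horner {n : ℕ} (L : SemiringLaws n) where
    open SemiringLaws L using (isZero⇒≃0; ≃0⇒isZero; commutativeSemiring)
    open CommutativeSemiring commutativeSemiring
      using (+-commutativeMonoid; +-identityˡ; +-identityʳ; +-cong; +-congʳ;
             *-cong; *-assoc; *-comm; *-identityˡ; distribˡ; zeroˡ; zeroʳ; refl; sym; trans)

    Coeffs : Set c
    Coeffs = List (Poly n)

    coeff : Coeffs → ℕ → Poly n
    coeff []       _       = 0P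
    coeff (p ∷ ps) zero    = p
    coeff (p ∷ ps) (suc k) = coeff ps k

    infix 4 _≋_
    record _≋_ (ps qs : Coeffs) : Set ℓ where
      constructor coeffwise
      field at : ∀ k → coeff ps k ≃ coeff qs k
    open _≋_

    ≋-isEquivalence : IsEquivalence _≋_
    ≋-isEquivalence = record
      { refl  = coeffwise λ _ → refl
      ; sym   = λ e → coeffwise λ k → sym (at e k)
      ; trans = λ e f → coeffwise λ k → trans (at e k) (at f k) }
    open IsEquivalence ≋-isEquivalence public
      using () renaming (refl to ≋-refl; sym to ≋-sym; trans to ≋-trans)

    ∷-cong : ∀ {p q ps qs} → p ≃ q → ps ≋ qs → (p ∷ ps) ≋ (q ∷ qs)
    ∷-cong e es = coeffwise λ { zero → e ; (suc k) → at es k }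

    0∷[]≋[] : (0P ∷ []) ≋ []
    0∷[]≋[] = coeffwise λ { zero → refl ; (suc k) → refl }

    isZeroL⇒≋[] : ∀ {ps} → IsZeroL ps → ps ≋ []
    isZeroL⇒≋[] {[]}     _        = ≋-refl
    isZeroL⇒≋[] {p ∷ ps} (z , zs) = ≋-trans (∷-cong (isZero⇒≃0 z) (isZeroL⇒≋[] zs)) 0∷[]≋[]

    ≋[]⇒isZeroL : ∀ {ps} → ps ≋ [] → IsZeroL ps
    ≋[]⇒isZeroL {[]}     _ = tt
    ≋[]⇒isZeroL {p ∷ ps} z = ≃0⇒isZero (at z zero) , ≋[]⇒isZeroL (coeffwise λ k → at z (suc k))

    ≈L⇒≋ : ∀ {ps qs} → ps ≈L qs → ps ≋ qs
    ≈L⇒≋ {[]}     {qs}     z        = ≋-sym (isZeroL⇒≋[] {qs} z)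
    ≈L⇒≋ {p ∷ ps} {[]}     z        = isZeroL⇒≋[] {p ∷ ps} z
    ≈L⇒≋ {p ∷ ps} {q ∷ qs} (e , es) = ∷-cong ⟨ e ⟩ (≈L⇒≋ {ps} {qs} es)

    ≋⇒≈L : ∀ {ps qs} → ps ≋ qs → ps ≈L qs
    ≋⇒≈L {[]}     {qs}     e = ≋[]⇒isZeroL (≋-sym e)
    ≋⇒≈L {p ∷ ps} {[]}     e = ≋[]⇒isZeroL e
    ≋⇒≈L {p ∷ ps} {q ∷ qs} e = unwrap (at e zero) , ≋⇒≈L {ps} {qs} (coeffwise λ k → at e (suc k))

    hor-cong : ∀ {ps qs} → ps ≋ qs → hor ps ≃ hor qs
    hor-cong e = ⟨ ≋⇒≈L e ⟩

    -- Addition is coefficientwise, so coeff is an injective monoid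
    -- homomorphism into the pointwise monoid of sequences.
    coeff-+ : ∀ ps qs k → coeff (ps +L qs) k ≃ coeff ps k +P coeff qs k
    coeff-+ []       qs       k       = sym (+-identityˡ _)
    coeff-+ (p ∷ ps) []       k       = sym (+-identityʳ _)
    coeff-+ (p ∷ ps) (q ∷ qs) zero    = refl
    coeff-+ (p ∷ ps) (q ∷ qs) (suc k) = coeff-+ ps qs k

    sequences : CommutativeMonoid c ℓ
    sequences = Pointwise.commutativeMonoid ℕ +-commutativeMonoid

    coeff-isMonoidMonomorphism :
      MonoidMorphisms.IsMonoidMonomorphism
        (record { Carrier = Coeffs ; _≈_ = _≋_ ; _∙_ = _+L_ ; ε = [] })
        (CommutativeMonoid.rawMonoid sequences) coeff
    coeff-isMonoidMonomorphism = record
      { isMonoidHomomorphism = record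
        { isMagmaHomomorphism = record
          { isRelHomomorphism = record { cong = at }
          ; homo = coeff-+ }
        ; ε-homo = λ _ → refl }
      ; injective = coeffwise }

    +L-isCommutativeMonoid : IsCommutativeMonoid _≋_ _+L_ []
    +L-isCommutativeMonoid =
      MonoidMonomorphism.isCommutativeMonoid coeff-isMonoidMonomorphism
        (CommutativeMonoid.isCommutativeMonoid sequences)

    +L-commutativeMonoid : CommutativeMonoid c ℓ
    +L-commutativeMonoid = record { isCommutativeMonoid = +L-isCommutativeMonoid }
    open CommutativeMonoid +L-commutativeMonoid public
      using () renaming (∙-cong to +L-cong; ∙-congˡ to +L-congˡ; ∙-congʳ to +L-congʳ;
                         identityʳ to +L-identityʳ)
    open CommutativeMonoid +L-commutativeMonoid using (setoid)
    open import Algebra.Properties.CommutativeSemigroup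
      (CommutativeMonoid.commutativeSemigroup +L-commutativeMonoid)
      using (interchange; x∙yz≈y∙xz)
    open import Relation.Binary.Reasoning.Setoid setoid

    coeff-scaleL : ∀ p qs k → coeff (scaleL p qs) k ≃ p *P coeff qs k
    coeff-scaleL p []       k       = sym (zeroʳ p)
    coeff-scaleL p (q ∷ qs) zero    = refl
    coeff-scaleL p (q ∷ qs) (suc k) = coeff-scaleL p qs k

    scaleL-cong : ∀ {p p′ qs qs′} → p ≃ p′ → qs ≋ qs′ → scaleL p qs ≋ scaleL p′ qs′
    scaleL-cong {p} {p′} {qs} {qs′} e es = coeffwise λ k →
      trans (coeff-scaleL p qs k) (trans (*-cong e (at es k)) (sym (coeff-scaleL p′ qs′ k)))

    scaleL-distrib : ∀ p qs rs → scaleL p (qs +L rs) ≋ scaleL p qs +L scaleL p rs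
    scaleL-distrib p qs rs = coeffwise λ k →
      trans (coeff-scaleL p (qs +L rs) k)
        (trans (*-cong refl (coeff-+ qs rs k))
          (trans (distribˡ p _ _)
            (sym (trans (coeff-+ (scaleL p qs) (scaleL p rs) k)
                        (+-cong (coeff-scaleL p qs k) (coeff-scaleL p rs k))))))

    scaleL-assoc : ∀ p q rs → scaleL (p *P q) rs ≋ scaleL p (scaleL q rs)
    scaleL-assoc p q rs = coeffwise λ k →
      trans (coeff-scaleL (p *P q) rs k)
        (trans (*-assoc p q _) (sym (trans (coeff-scaleL p (scaleL q rs) k) (*-cong refl (coeff-scaleL q rs k)))))

    scaleL-identity : ∀ qs → scaleL 1P qs ≋ qs
    scaleL-identity qs = coeffwise λ k → trans (coeff-scaleL 1P qs k) (*-identityˡ _)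

    scaleL-zero : ∀ qs → scaleL 0P qs ≋ []
    scaleL-zero qs = coeffwise λ k → trans (coeff-scaleL 0P qs k) (zeroˡ _)

    *L-congʳ : ∀ ps {qs qs′} → qs ≋ qs′ → ps *L qs ≋ ps *L qs′
    *L-congʳ []       e = ≋-refl
    *L-congʳ (p ∷ ps) e = +L-cong (scaleL-cong refl e) (∷-cong refl (*L-congʳ ps e))

    *L-zeroʳ : ∀ ps → ps *L [] ≋ []
    *L-zeroʳ []       = ≋-refl
    *L-zeroʳ (p ∷ ps) = ≋-trans (∷-cong refl (*L-zeroʳ ps)) 0∷[]≋[]

    *L-consʳ : ∀ ps q qs → ps *L (q ∷ qs) ≋ scaleL q ps +L (0P ∷ ps *L qs)
    *L-consʳ []       q qs = ≋-sym 0∷[]≋[]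
    *L-consʳ (p ∷ ps) q qs = ∷-cong (+-congʳ (*-comm p q)) (begin
      scaleL p qs +L ps *L (q ∷ qs)
        ≈⟨ +L-congˡ (*L-consʳ ps q qs) ⟩
      scaleL p qs +L (scaleL q ps +L (0P ∷ ps *L qs))
        ≈⟨ x∙yz≈y∙xz (scaleL p qs) (scaleL q ps) _ ⟩
      scaleL q ps +L (scaleL p qs +L (0P ∷ ps *L qs)) ∎)

    *L-comm : ∀ ps qs → ps *L qs ≋ qs *L ps
    *L-comm []       qs = ≋-sym (*L-zeroʳ qs)
    *L-comm (p ∷ ps) qs =
      ≋-trans (+L-congˡ (∷-cong refl (*L-comm ps qs))) (≋-sym (*L-consʳ qs p ps))

    *L-cong : ∀ {ps ps′ qs qs′} → ps ≋ ps′ → qs ≋ qs′ → ps *L qs ≋ ps′ *L qs′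
    *L-cong {ps} {ps′} {qs} {qs′} e f = begin
      ps *L qs   ≈⟨ *L-congʳ ps f ⟩
      ps *L qs′  ≈⟨ *L-comm ps qs′ ⟩
      qs′ *L ps  ≈⟨ *L-congʳ qs′ e ⟩
      qs′ *L ps′ ≈⟨ *L-comm qs′ ps′ ⟩
      ps′ *L qs′ ∎

    *L-identityˡ : ∀ qs → (1P ∷ []) *L qs ≋ qs
    *L-identityˡ qs = ≋-trans (+L-cong (scaleL-identity qs) 0∷[]≋[]) (+L-identityʳ qs)

    *L-distribˡ : ∀ ps qs rs → ps *L (qs +L rs) ≋ ps *L qs +L ps *L rs
    *L-distribˡ []       qs rs = ≋-refl
    *L-distribˡ (p ∷ ps) qs rs = begin
      scaleL p (qs +L rs) +L (0P ∷ ps *L (qs +L rs))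
        ≈⟨ +L-cong (scaleL-distrib p qs rs) (∷-cong (sym (+-identityˡ 0P)) (*L-distribˡ ps qs rs)) ⟩
      (scaleL p qs +L scaleL p rs) +L ((0P ∷ ps *L qs) +L (0P ∷ ps *L rs))
        ≈⟨ interchange (scaleL p qs) (scaleL p rs) _ _ ⟩
      (scaleL p qs +L (0P ∷ ps *L qs)) +L (scaleL p rs +L (0P ∷ ps *L rs)) ∎

    *L-distribʳ : ∀ ps qs rs → (qs +L rs) *L ps ≋ qs *L ps +L rs *L ps
    *L-distribʳ ps qs rs = begin
      (qs +L rs) *L ps        ≈⟨ *L-comm (qs +L rs) ps ⟩
      ps *L (qs +L rs)        ≈⟨ *L-distribˡ ps qs rs ⟩
      ps *L qs +L ps *L rs    ≈⟨ +L-cong (*L-comm ps qs) (*L-comm ps rs) ⟩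
      qs *L ps +L rs *L ps    ∎

    0∷-*L : ∀ ps qs → (0P ∷ ps) *L qs ≋ 0P ∷ ps *L qs
    0∷-*L ps qs = +L-congʳ (scaleL-zero qs)

    scaleL-*L : ∀ p qs rs → scaleL p qs *L rs ≋ scaleL p (qs *L rs)
    scaleL-*L p []       rs = ≋-refl
    scaleL-*L p (q ∷ qs) rs = begin
      scaleL (p *P q) rs +L (0P ∷ scaleL p qs *L rs)
        ≈⟨ +L-cong (scaleL-assoc p q rs) (∷-cong (sym (zeroʳ p)) (scaleL-*L p qs rs)) ⟩
      scaleL p (scaleL q rs) +L scaleL p (0P ∷ qs *L rs)
        ≈⟨ ≋-sym (scaleL-distrib p (scaleL q rs) _) ⟩
      scaleL p (scaleL q rs +L (0P ∷ qs *L rs)) ∎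

    *L-assoc : ∀ ps qs rs → (ps *L qs) *L rs ≋ ps *L (qs *L rs)
    *L-assoc []       qs rs = ≋-refl
    *L-assoc (p ∷ ps) qs rs = begin
      (scaleL p qs +L (0P ∷ ps *L qs)) *L rs
        ≈⟨ *L-distribʳ rs (scaleL p qs) _ ⟩
      scaleL p qs *L rs +L (0P ∷ ps *L qs) *L rs
        ≈⟨ +L-cong (scaleL-*L p qs rs) (≋-trans (0∷-*L (ps *L qs) rs) (∷-cong refl (*L-assoc ps qs rs))) ⟩
      scaleL p (qs *L rs) +L (0P ∷ ps *L (qs *L rs)) ∎

    *L-isCommutativeMonoid : IsCommutativeMonoid _≋_ _*L_ (1P ∷ [])
    *L-isCommutativeMonoid = isCommutativeMonoidˡ (record
      { isSemigroup = record
        { isMagma = record { isEquivalence = ≋-isEquivalence ; ∙-cong = *L-cong }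
        ; assoc   = *L-assoc }
      ; identityˡ = *L-identityˡ
      ; comm      = *L-comm })

    -- Poly (suc n) is a copy of the coefficient lists modulo _≋_, so the
    -- monoid laws transfer along the injective map hor ps ↦ ps.
    coefficients : Poly (suc n) → Coeffs
    coefficients (hor ps) = ps

    coefficients-isMonoidMonomorphism :
      ∀ (_∙_ : Op₂ (Poly (suc n))) (_∙L_ : Op₂ Coeffs) ε εL →
      (∀ ps qs → coefficients (hor ps ∙ hor qs) ≋ ps ∙L qs) → coefficients ε ≋ εL →
      MonoidMorphisms.IsMonoidMonomorphism
        (record { Carrier = Poly (suc n) ; _≈_ = _≃_ ; _∙_ = _∙_ ; ε = ε })
        (record { Carrier = Coeffs ; _≈_ = _≋_ ; _∙_ = _∙L_ ; ε = εL }) coefficients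
    coefficients-isMonoidMonomorphism _∙_ _∙L_ ε εL homo ε-homo = record
      { isMonoidHomomorphism = record
        { isMagmaHomomorphism = record
          { isRelHomomorphism = record { cong = λ { {hor ps} {hor qs} ⟨ e ⟩ → ≈L⇒≋ {ps} {qs} e } }
          ; homo = λ { (hor ps) (hor qs) → homo ps qs } }
        ; ε-homo = ε-homo }
      ; injective = λ { {hor ps} {hor qs} → hor-cong } }

    laws : SemiringLaws (suc n)
    laws = record
      { isCommutativeSemiring = isCommutativeSemiringˡ (record
          { +-isCommutativeMonoid = MonoidMonomorphism.isCommutativeMonoid
              (coefficients-isMonoidMonomorphism _+P_ _+L_ 0P [] (λ _ _ → ≋-refl) 0∷[]≋[])
              +L-isCommutativeMonoid
          ; *-isCommutativeMonoid = MonoidMonomorphism.isCommutativeMonoid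
              (coefficients-isMonoidMonomorphism _*P_ _*L_ 1P (1P ∷ []) (λ _ _ → ≋-refl) ≋-refl)
              *L-isCommutativeMonoid
          ; distribʳ = λ { (hor ps) (hor qs) (hor rs) → hor-cong (*L-distribʳ ps qs rs) }
          ; zeroˡ    = λ { (hor ps) → hor-cong (0∷-*L [] ps) } })
      ; isZero⇒≃0 = λ { {hor ps} z → hor-cong (≋-trans (isZeroL⇒≋[] z) (≋-sym 0∷[]≋[])) }
      ; ≃0⇒isZero = λ { {hor ps} ⟨ e ⟩ → ≋[]⇒isZeroL (≋-trans (≈L⇒≋ {ps} e) 0∷[]≋[]) } }

  semiringLaws : ∀ n → SemiringLaws n
  semiringLaws zero    = laws₀
  semiringLaws (suc n) = Horner.laws (semiringLaws n)

  polySemiring : ℕ → CommutativeSemiring c ℓ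
  polySemiring n = SemiringLaws.commutativeSemiring (semiringLaws n)

  -- A polynomial in n variables viewed as a polynomial in suc n variables
  -- not depending on the first one.  It is a semiring embedding (additivity
  -- and the constants hold definitionally).
  lift : ∀ {n} → Poly n → Poly (suc n)
  lift p = hor (p ∷ [])

  lift-cong : ∀ {n} {p q : Poly n} → p ≃ q → lift p ≃ lift q
  lift-cong ⟨ e ⟩ = ⟨ e , tt ⟩

  lift-* : ∀ {n} (p q : Poly n) → lift (p *P q) ≃ lift p *P lift q
  lift-* {n} p q = ⟨ unwrap (sym (+-identityʳ (p *P q))) , tt ⟩
    where open CommutativeSemiring (polySemiring n) using (sym; +-identityʳ)

  constP-+ : ∀ {n} a b → constP {n} (a K.+ b) ≃ constP a +P constP b
  constP-+ {zero}  a b = ⟨ K.refl ⟩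
  constP-+ {suc n} a b = lift-cong (constP-+ a b)

  constP-* : ∀ {n} a b → constP {n} (a K.* b) ≃ constP a *P constP b
  constP-* {zero}  a b = ⟨ K.refl ⟩
  constP-* {suc n} a b = CommutativeSemiring.trans (polySemiring (suc n))
    (lift-cong (constP-* a b)) (lift-* (constP a) (constP b))

  infixl 6 _+U_
  infixl 7 _*U_
  _+U_ : UPoly → UPoly → UPoly
  []      +U v       = v
  (a ∷ u) +U []      = a ∷ u
  (a ∷ u) +U (b ∷ v) = (a K.+ b) ∷ (u +U v)

  scaleU : K.Carrier → UPoly → UPoly
  scaleU a []      = []
  scaleU a (b ∷ v) = (a K.* b) ∷ scaleU a v

  _*U_ : UPoly → UPoly → UPoly
  []      *U v = []
  (a ∷ u) *U v = scaleU a v +U (K.0# ∷ (u *U v))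

  ∑U : (d : ℕ) → (Fin d → UPoly) → UPoly
  ∑U zero    f = []
  ∑U (suc d) f = f zero +U ∑U d (λ b → f (suc b))

  module _ {n : ℕ} where
    open Horner (semiringLaws n)

    map-constP-+ : ∀ u v → map constP (u +U v) ≋ map constP u +L map constP v
    map-constP-+ []      v       = ≋-refl
    map-constP-+ (a ∷ u) []      = ≋-refl
    map-constP-+ (a ∷ u) (b ∷ v) = ∷-cong (constP-+ a b) (map-constP-+ u v)

    map-constP-scale : ∀ a v → map constP (scaleU a v) ≋ scaleL (constP a) (map constP v)
    map-constP-scale a []      = ≋-refl
    map-constP-scale a (b ∷ v) = ∷-cong (constP-* a b) (map-constP-scale a v)

    map-constP-* : ∀ u v → map constP (u *U v) ≋ map constP u *L map constP v
    map-constP-* []      v = ≋-refl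
    map-constP-* (a ∷ u) v = ≋-trans (map-constP-+ (scaleU a v) (K.0# ∷ (u *U v)))
      (+L-cong (map-constP-scale a v) (∷-cong refl (map-constP-* u v)))
      where open CommutativeSemiring (polySemiring n) using (refl)

  embed-+ : ∀ {n} (i : Fin n) u v → embed i (u +U v) ≃ embed i u +P embed i v
  embed-+ {suc n} zero    u v = Horner.hor-cong (semiringLaws n) (map-constP-+ u v)
  embed-+ {suc n} (suc i) u v = lift-cong (embed-+ i u v)

  embed-* : ∀ {n} (i : Fin n) u v → embed i (u *U v) ≃ embed i u *P embed i v
  embed-* {suc n} zero    u v = Horner.hor-cong (semiringLaws n) (map-constP-* u v)
  embed-* {suc n} (suc i) u v = CommutativeSemiring.trans (polySemiring (suc n))
    (lift-cong (embed-* i u v)) (lift-* (embed i u) (embed i v))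

  embed-0 : ∀ {n} (i : Fin n) → embed i [] ≃ 0P
  embed-0 {suc n} zero    = hor-cong (≋-sym 0∷[]≋[])
    where open Horner (semiringLaws n) using (hor-cong; ≋-sym; 0∷[]≋[])
  embed-0 {suc n} (suc i) = lift-cong (embed-0 i)

  embed-1 : ∀ {n} (i : Fin n) → embed i (K.1# ∷ []) ≃ 1P
  embed-1 {suc n} zero    = CommutativeSemiring.refl (polySemiring (suc n))
  embed-1 {suc n} (suc i) = lift-cong (embed-1 i)

module Segments {c ℓ : Level} (R : CommutativeRing c ℓ) (n : ℕ) where
  open ABPs R
  open PolynomialSemiring R
  private module K = CommutativeRing R
  open CommutativeSemiring (polySemiring n) hiding (_+_; _*_; 0#; 1#; Carrier; zero)
  open import Algebra.Properties.Semiring.Sum (CommutativeSemiring.semiring (polySemiring n))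
  open import Algebra.Properties.CommutativeSemigroup *-commutativeSemigroup
    using () renaming (interchange to *-interchange)
  open import Relation.Binary.Reasoning.Setoid setoid

  sumP≡∑ : ∀ d (f : Fin d → Poly n) → sumP d f ≡ ∑[ b < d ] f b
  sumP≡∑ zero    f = ≡.refl
  sumP≡∑ (suc d) f = ≡.cong (f zero +P_) (sumP≡∑ d (λ b → f (suc b)))

  ∑-↑ : ∀ d e (f : Fin (d + e) → Poly n) →
        ∑[ t < d + e ] f t ≈ ∑[ a < d ] f (a ↑ˡ e) +P ∑[ b < e ] f (d ↑ʳ b)
  ∑-↑ zero    e f = sym (+-identityˡ _)
  ∑-↑ (suc d) e f = trans (+-congˡ (∑-↑ d e (λ t → f (suc t)))) (sym (+-assoc _ _ _))

  ∑-combine : ∀ d e (f : Fin (d * e) → Poly n) →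
              ∑[ t < d * e ] f t ≈ ∑[ a < d ] ∑[ b < e ] f (combine a b)
  ∑-combine zero    e f = refl
  ∑-combine (suc d) e f =
    trans (∑-↑ e (d * e) f) (+-congˡ (∑-combine d e (λ t → f (e ↑ʳ t))))

  ∑∑-combine : ∀ d₁ d₂ e₁ e₂ (f : Fin (d₁ * d₂) → Fin (e₁ * e₂) → Poly n) →
               ∑[ s < d₁ * d₂ ] ∑[ t < e₁ * e₂ ] f s t ≈
               ∑[ a < d₁ ] ∑[ a′ < d₂ ] ∑[ b < e₁ ] ∑[ b′ < e₂ ] f (combine a a′) (combine b b′)
  ∑∑-combine d₁ d₂ e₁ e₂ f = trans (∑-combine d₁ d₂ (λ s → ∑[ t < e₁ * e₂ ] f s t))
    (sum-cong-≋ {d₁} (λ a → sum-cong-≋ {d₂} (λ a′ → ∑-combine e₁ e₂ (f (combine a a′)))))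

  ∑-*-swap : ∀ {d e} (x : Fin d → Poly n) (B : Fin d → Fin e → Poly n) →
             ∑[ b < d ] (x b *P ∑[ g < e ] B b g) ≈ ∑[ g < e ] ∑[ b < d ] (x b *P B b g)
  ∑-*-swap x B = trans (sum-cong-≋ (λ b → *-distribˡ-sum (x b) (B b))) (∑-comm (λ b g → x b *P B b g))

  ∑-*-assoc : ∀ {d e} (x : Fin d → Poly n) (B : Fin d → Fin e → Poly n) (y : Fin e → Poly n) →
              ∑[ b < d ] (x b *P ∑[ g < e ] (B b g *P y g)) ≈ ∑[ g < e ] (∑[ b < d ] (x b *P B b g) *P y g)
  ∑-*-assoc {d} {e} x B y = begin
    ∑[ b < d ] (x b *P ∑[ g < e ] (B b g *P y g))
      ≈⟨ ∑-*-swap x (λ b g → B b g *P y g) ⟩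
    ∑[ g < e ] ∑[ b < d ] (x b *P (B b g *P y g))
      ≈⟨ sum-cong-≋ (λ g → sum-cong-≋ (λ b → *-assoc (x b) (B b g) (y g))) ⟨
    ∑[ g < e ] ∑[ b < d ] ((x b *P B b g) *P y g)
      ≈⟨ sum-cong-≋ (λ g → *-distribʳ-sum (y g) (λ b → x b *P B b g)) ⟨
    ∑[ g < e ] (∑[ b < d ] (x b *P B b g) *P y g) ∎

  ∑-*-∑ : ∀ {d e} (f : Fin d → Poly n) (g : Fin e → Poly n) →
          ∑[ a < d ] f a *P ∑[ b < e ] g b ≈ ∑[ a < d ] ∑[ b < e ] (f a *P g b)
  ∑-*-∑ f g = trans (*-distribʳ-sum _ f) (sum-cong-≋ (λ a → *-distribˡ-sum (f a) g))

  -- Kronecker delta: the transfer matrix of an empty segment.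
  χ : Bool → Poly n
  χ true  = 1P
  χ false = 0P

  δ : ∀ {d} → Fin d → Fin d → Poly n
  δ a b = χ (does (a ≟ b))

  δ-refl : ∀ {d} (a : Fin d) → δ a a ≡ 1P
  δ-refl a = ≡.cong χ (dec-true (a ≟ a) ≡.refl)
  δ-≢ : ∀ {d} {a b : Fin d} → a ≢ b → δ a b ≡ 0P
  δ-≢ {a = a} {b} a≢b = ≡.cong χ (dec-false (a ≟ b) a≢b)

  ∑-zero : ∀ d {f : Fin d → Poly n} → (∀ b → f b ≈ 0P) → ∑[ b < d ] f b ≈ 0P
  ∑-zero d f≈0 = trans (sum-cong-≋ f≈0) (sum-replicate-zero d)

  δ-select : ∀ {d} (a : Fin d) (f : Fin d → Poly n) → ∑[ b < d ] (δ a b *P f b) ≈ f a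
  δ-select {suc d} zero f =
    trans (+-cong (*-identityˡ (f zero)) (∑-zero d (λ b → zeroˡ (f (suc b))))) (+-identityʳ (f zero))
  δ-select {suc d} (suc a) f =
    trans (+-cong (zeroˡ (f zero)) (δ-select a (λ b → f (suc b)))) (+-identityˡ (f (suc a)))
  δ-selectʳ : ∀ {d} (a : Fin d) (f : Fin d → Poly n) → ∑[ b < d ] (f b *P δ b a) ≈ f a
  δ-selectʳ {suc d} zero f =
    trans (+-cong (*-identityʳ (f zero)) (∑-zero d (λ b → zeroʳ (f (suc b))))) (+-identityʳ (f zero))
  δ-selectʳ {suc d} (suc a) f =
    trans (+-cong (zeroʳ (f zero)) (δ-selectʳ a (λ b → f (suc b)))) (+-identityˡ (f (suc a)))

  δ-combine : ∀ {d e} (a b : Fin d) (a′ b′ : Fin e) →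
              δ (combine a a′) (combine b b′) ≈ δ a b *P δ a′ b′
  δ-combine a b a′ b′ with a ≟ b | a′ ≟ b′
  ... | no a≢b | _
    rewrite δ-≢ (a≢b ∘ combine-injectiveˡ a a′ b b′) = sym (zeroˡ _)
  ... | yes ≡.refl | no a′≢b′
    rewrite δ-≢ (a′≢b′ ∘ combine-injectiveʳ a a′ a b′) = sym (zeroʳ 1P)
  ... | yes ≡.refl | yes ≡.refl
    rewrite δ-refl (combine a a′) = sym (*-identityˡ 1P)

  -- Guessing the next vertex: a guess g is paid for by δ g h, which keeps
  -- only the guesses that match the vertex h actually reached.
  ∑-guess : ∀ {e G H} (s : Fin e → Poly n) (X : Fin e → Fin G → Fin H → Poly n) →
            ∑[ g < e ] ∑[ γ < G ] ∑[ h < e ] ∑[ η < H ] ((δ g h *P s h) *P X g γ η) ≈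
            ∑[ g < e ] (s g *P ∑[ γ < G ] ∑[ η < H ] X g γ η)
  ∑-guess {e} {G} {H} s X = begin
    ∑[ g < e ] ∑[ γ < G ] ∑[ h < e ] ∑[ η < H ] ((δ g h *P s h) *P X g γ η)
      ≈⟨ sum-cong-≋ (λ g → sum-cong-≋ (λ γ → sum-cong-≋ (λ h →
           sym (*-distribˡ-sum (δ g h *P s h) (X g γ))))) ⟩
    ∑[ g < e ] ∑[ γ < G ] ∑[ h < e ] ((δ g h *P s h) *P Y g γ)
      ≈⟨ sum-cong-≋ (λ g → sum-cong-≋ (λ γ → sum-cong-≋ (λ h → *-assoc (δ g h) (s h) (Y g γ)))) ⟩
    ∑[ g < e ] ∑[ γ < G ] ∑[ h < e ] (δ g h *P (s h *P Y g γ))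
      ≈⟨ sum-cong-≋ (λ g → sum-cong-≋ (λ γ → δ-select g (λ h → s h *P Y g γ))) ⟩
    ∑[ g < e ] ∑[ γ < G ] (s g *P Y g γ)
      ≈⟨ sum-cong-≋ (λ g → *-distribˡ-sum (s g) (Y g)) ⟨
    ∑[ g < e ] (s g *P ∑[ γ < G ] Y g γ) ∎
    where
    Y : Fin e → Fin G → Poly n
    Y g γ = ∑[ η < H ] X g γ η

  χU : Bool → UPoly
  χU true  = K.1# ∷ []
  χU false = []

  embed-χ : (i : Fin n) (x : Bool) → embed i (χU x) ≈ χ x
  embed-χ i true  = embed-1 i
  embed-χ i false = embed-0 i
  embed-∑ : (i : Fin n) (d : ℕ) (f : Fin d → UPoly) → embed i (∑U d f) ≈ ∑[ b < d ] embed i (f b)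
  embed-∑ i zero    f = embed-0 i
  embed-∑ i (suc d) f = trans (embed-+ i (f zero) _) (+-congˡ (embed-∑ i d (λ b → f (suc b))))

  -- A segment of an oblivious ABP: edge layers reading vs, leading from a
  -- layer of d vertices to a layer of e vertices, all later layers of
  -- size ≤ w.
  data Segment (w : ℕ) : ℕ → ℕ → List (Fin n) → Set c where
    nil  : ∀ {d} → Segment w d d []
    cons : ∀ {d e vs} (d′ : ℕ) (i : Fin n) → (Fin d → Fin d′ → UPoly) →
           d′ ≤ w → Segment w d′ e vs → Segment w d e (i ∷ vs)

  transfer : ∀ {w d e vs} → Segment w d e vs → Fin d → Fin e → Poly n
  transfer nil                a b = δ a b
  transfer (cons d′ i M _ S) a b = ∑[ g < d′ ] (embed i (M a g) *P transfer S g b)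

  record Cut {w d} (vs us : List (Fin n)) (P : Prog n w d (vs ++ us)) : Set (c ⊔ ℓ) where
    field
      e     : ℕ
      front : Segment w d e vs
      back  : Prog n w e us
      eval  : ∀ a → evalFrom P a ≈ ∑[ g < e ] (transfer front a g *P evalFrom back g)

  cut : ∀ {w d} vs {us} (P : Prog n w d (vs ++ us)) → Cut vs us P
  cut []       P = record { front = nil ; back = P ; eval = λ a → sym (δ-select a (evalFrom P)) }
  cut (i ∷ vs) (layer d′ .i M p P) = record { front = cons d′ i M p front ; back = back ; eval = eval′ }
    where
    open Cut (cut vs P)
    eval′ : ∀ a → evalFrom (layer d′ i M p P) a ≈
                  ∑[ g < e ] (transfer (cons d′ i M p front) a g *P evalFrom back g)
    eval′ a = begin
      evalFrom (layer d′ i M p P) a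
        ≡⟨ sumP≡∑ d′ _ ⟩
      ∑[ b < d′ ] (embed i (M a b) *P evalFrom P b)
        ≈⟨ sum-cong-≋ (λ b → *-congˡ (eval b)) ⟩
      ∑[ b < d′ ] (embed i (M a b) *P ∑[ g < e ] (transfer front b g *P evalFrom back g))
        ≈⟨ ∑-*-assoc (λ b → embed i (M a b)) (transfer front) (evalFrom back) ⟩
      ∑[ g < e ] (transfer (cons d′ i M p front) a g *P evalFrom back g) ∎

  toProg : ∀ {w d vs} → Segment w d 1 vs → 1 ≤ w → Prog n w d vs
  toProg nil               o = sink o
  toProg (cons d′ i M p S) o = layer d′ i M p (toProg S o)

  evalFrom-toProg : ∀ {w d vs} (S : Segment w d 1 vs) (o : 1 ≤ w) a →
                    evalFrom (toProg S o) a ≈ transfer S a zero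
  evalFrom-toProg nil               o zero = refl
  evalFrom-toProg (cons d′ i M p S) o a  =
    trans (reflexive (sumP≡∑ d′ _)) (sum-cong-≋ (λ b → *-congˡ (evalFrom-toProg S o b)))

  -- Tensor product of two segments reading the same variables: layers of
  -- vertex pairs (encoded by combine), edge labels multiplied.
  _⊗_ : ∀ {d₁ d₁′ d₂ d₂′} → (Fin d₁ → Fin d₁′ → UPoly) → (Fin d₂ → Fin d₂′ → UPoly) →
        Fin (d₁ * d₂) → Fin (d₁′ * d₂′) → UPoly
  _⊗_ {d₁} {d₁′} {d₂} {d₂′} M N x y =
    M (quotient d₂ x) (quotient d₂′ y) *U N (remainder {d₁} d₂ x) (remainder {d₁′} d₂′ y)

  ⊗-combine : ∀ {d₁ d₁′ d₂ d₂′} (M : Fin d₁ → Fin d₁′ → UPoly) (N : Fin d₂ → Fin d₂′ → UPoly)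
              a a′ c c′ → (M ⊗ N) (combine a a′) (combine c c′) ≡ M a c *U N a′ c′
  ⊗-combine {d₂ = d₂} {d₂′} M N a a′ c c′ =
    ≡.cong₂ (λ r s → M (proj₁ r) (proj₁ s) *U N (proj₂ r) (proj₂ s))
            (remQuot-combine {k = d₂} a a′) (remQuot-combine {k = d₂′} c c′)

  tensor : ∀ {w₁ w₂ d₁ d₂ e₁ e₂ vs} → Segment w₁ d₁ e₁ vs → Segment w₂ d₂ e₂ vs →
           Segment (w₁ * w₂) (d₁ * d₂) (e₁ * e₂) vs
  tensor nil                nil                 = nil
  tensor (cons d₁′ i M p S) (cons d₂′ .i N q T) =
    cons (d₁′ * d₂′) i (M ⊗ N) (ℕₚ.*-mono-≤ p q) (tensor S T)

  transfer-tensor : ∀ {w₁ w₂ d₁ d₂ e₁ e₂ vs} (S : Segment w₁ d₁ e₁ vs) (T : Segment w₂ d₂ e₂ vs)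
                    a a′ b b′ → transfer (tensor S T) (combine a a′) (combine b b′) ≈ transfer S a b *P transfer T a′ b′
  transfer-tensor nil nil a a′ b b′ = δ-combine a b a′ b′
  transfer-tensor (cons d₁′ i M p S) (cons d₂′ .i N q T) a a′ b b′ = begin
    ∑[ t < d₁′ * d₂′ ] (embed i ((M ⊗ N) (combine a a′) t) *P transfer (tensor S T) t (combine b b′))
      ≈⟨ ∑-combine d₁′ d₂′ _ ⟩
    ∑[ g < d₁′ ] ∑[ g′ < d₂′ ] (embed i ((M ⊗ N) (combine a a′) (combine g g′)) *P
                                transfer (tensor S T) (combine g g′) (combine b b′))
      ≈⟨ sum-cong-≋ (λ g → sum-cong-≋ (λ g′ →
           *-cong (factor g g′) (transfer-tensor S T g g′ b b′))) ⟩
    ∑[ g < d₁′ ] ∑[ g′ < d₂′ ] ((x g *P y g′) *P (transfer S g b *P transfer T g′ b′))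
      ≈⟨ sum-cong-≋ (λ g → sum-cong-≋ (λ g′ →
           *-interchange (x g) (y g′) (transfer S g b) (transfer T g′ b′))) ⟩
    ∑[ g < d₁′ ] ∑[ g′ < d₂′ ] ((x g *P transfer S g b) *P (y g′ *P transfer T g′ b′))
      ≈⟨ ∑-*-∑ (λ g → x g *P transfer S g b) (λ g′ → y g′ *P transfer T g′ b′) ⟨
    ∑[ g < d₁′ ] (x g *P transfer S g b) *P ∑[ g′ < d₂′ ] (y g′ *P transfer T g′ b′) ∎
    where
    x : Fin d₁′ → Poly n
    x g = embed i (M a g)
    y : Fin d₂′ → Poly n
    y g′ = embed i (N a′ g′)
    factor : ∀ g g′ → embed i ((M ⊗ N) (combine a a′) (combine g g′)) ≈ x g *P y g′
    factor g g′ =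
      trans (reflexive (≡.cong (embed i) (⊗-combine M N a a′ g g′))) (embed-* i (M a g) (N a′ g′))

  identitySeg : ∀ {w} (e : ℕ) → e ≤ w → (vs : List (Fin n)) → Segment w e e vs
  identitySeg e e≤w []       = nil
  identitySeg e e≤w (i ∷ vs) = cons e i (λ a b → χU (does (a ≟ b))) e≤w (identitySeg e e≤w vs)

  transfer-identitySeg : ∀ {w} e (e≤w : e ≤ w) vs a b → transfer (identitySeg e e≤w vs) a b ≈ δ a b
  transfer-identitySeg e e≤w []       a b = refl
  transfer-identitySeg e e≤w (i ∷ vs) a b = begin
    ∑[ g < e ] (embed i (χU (does (a ≟ g))) *P transfer (identitySeg e e≤w vs) g b)
      ≈⟨ sum-cong-≋ (λ g → *-cong (embed-χ i (does (a ≟ g))) (transfer-identitySeg e e≤w vs g b)) ⟩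
    ∑[ g < e ] (δ a g *P δ g b)
      ≈⟨ δ-select a (λ g → δ g b) ⟩
    δ a b ∎

  weaken : ∀ {w w′ d e vs} → w ≤ w′ → Segment w d e vs → Segment w′ d e vs
  weaken w≤w′ nil               = nil
  weaken w≤w′ (cons d′ i M p S) = cons d′ i M (ℕₚ.≤-trans p w≤w′) (weaken w≤w′ S)

  transfer-weaken : ∀ {w w′ d e vs} (w≤w′ : w ≤ w′) (S : Segment w d e vs) a b →
                    transfer (weaken w≤w′ S) a b ≈ transfer S a b
  transfer-weaken w≤w′ nil               a b = refl
  transfer-weaken w≤w′ (cons d′ i M p S) a b =
    sum-cong-≋ (λ g → *-congˡ (transfer-weaken w≤w′ S g b))

  lastWidth : ∀ {w d e i vs} → Segment w d e (i ∷ vs) → e ≤ w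
  lastWidth (cons d′ i M p nil)             = p
  lastWidth (cons d′ i M p S@(cons _ _ _ _ _)) = lastWidth S

  mergeSources : ∀ {w D E i vs} → Segment w D E (i ∷ vs) → (G : ℕ) → (Fin G → Fin D) →
                 Segment w 1 E (i ∷ vs)
  mergeSources (cons d′ i M p S) G σ = cons d′ i (λ _ b → ∑U G (λ γ → M (σ γ) b)) p S

  transfer-mergeSources : ∀ {w D E i vs} (S : Segment w D E (i ∷ vs)) G (σ : Fin G → Fin D) t →
                          transfer (mergeSources S G σ) zero t ≈ ∑[ γ < G ] transfer S (σ γ) t
  transfer-mergeSources (cons d′ i M p S) G σ t = begin
    ∑[ b < d′ ] (embed i (∑U G (λ γ → M (σ γ) b)) *P transfer S b t)
      ≈⟨ sum-cong-≋ (λ b → *-congʳ (embed-∑ i G (λ γ → M (σ γ) b))) ⟩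
    ∑[ b < d′ ] (∑[ γ < G ] embed i (M (σ γ) b) *P transfer S b t)
      ≈⟨ sum-cong-≋ (λ b → *-distribʳ-sum (transfer S b t) (λ γ → embed i (M (σ γ) b))) ⟩
    ∑[ b < d′ ] ∑[ γ < G ] (embed i (M (σ γ) b) *P transfer S b t)
      ≈⟨ ∑-comm (λ b γ → embed i (M (σ γ) b) *P transfer S b t) ⟩
    ∑[ γ < G ] ∑[ b < d′ ] (embed i (M (σ γ) b) *P transfer S b t) ∎

  mergeSinks : ∀ {w D E i vs} → Segment w D E (i ∷ vs) → 1 ≤ w → (H : ℕ) → (Fin H → Fin E) →
               Segment w D 1 (i ∷ vs)
  mergeSinks (cons d′ i M p nil)                o H τ = cons 1 i (λ a _ → ∑U H (λ η → M a (τ η))) o nil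
  mergeSinks (cons d′ i M p S@(cons _ _ _ _ _)) o H τ = cons d′ i M p (mergeSinks S o H τ)

  transfer-mergeSinks : ∀ {w D E i vs} (S : Segment w D E (i ∷ vs)) (o : 1 ≤ w) H (τ : Fin H → Fin E) a →
                        transfer (mergeSinks S o H τ) a zero ≈ ∑[ η < H ] transfer S a (τ η)
  transfer-mergeSinks (cons d′ i M p nil) o H τ a = begin
    ∑[ b < 1 ] (embed i (∑U H (λ η → M a (τ η))) *P δ b zero)
      ≈⟨ δ-selectʳ {1} zero (λ _ → embed i (∑U H (λ η → M a (τ η)))) ⟩
    embed i (∑U H (λ η → M a (τ η)))
      ≈⟨ embed-∑ i H (λ η → M a (τ η)) ⟩
    ∑[ η < H ] embed i (M a (τ η))
      ≈⟨ sum-cong-≋ (λ η → δ-selectʳ (τ η) (λ b → embed i (M a b))) ⟨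
    ∑[ η < H ] ∑[ b < d′ ] (embed i (M a b) *P δ b (τ η)) ∎
  transfer-mergeSinks (cons d′ i M p S@(cons _ _ _ _ _)) o H τ a = begin
    ∑[ b < d′ ] (embed i (M a b) *P transfer (mergeSinks S o H τ) b zero)
      ≈⟨ sum-cong-≋ (λ b → *-congˡ (transfer-mergeSinks S o H τ b)) ⟩
    ∑[ b < d′ ] (embed i (M a b) *P ∑[ η < H ] transfer S b (τ η))
      ≈⟨ ∑-*-swap (λ b → embed i (M a b)) (λ b η → transfer S b (τ η)) ⟩
    ∑[ η < H ] ∑[ b < d′ ] (embed i (M a b) *P transfer S b (τ η)) ∎

module ReadOnce {c ℓ : Level} (R : CommutativeRing c ℓ) (n : ℕ) where
  open ABPs R
  open PolynomialSemiring R
  open Segments R n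
  open CommutativeSemiring (polySemiring n)
    using (_≈_; refl; sym; trans; +-identityʳ; *-congˡ; *-congʳ; setoid)
  open import Algebra.Properties.Semiring.Sum (CommutativeSemiring.semiring (polySemiring n))
    using (sum-cong-≋; ∑-comm; sum-syntax)
  open import Relation.Binary.Reasoning.Setoid setoid

  passes : ℕ → List (Fin n) → List (Fin n)
  passes k vs = concat (replicate k vs)

  -- A single-pass representation of width W of a program P: a segment T
  -- reading vs once, with P's value at a source a being the total weight
  -- of T between the source family σ a and the sink family τ.
  record SinglePass (W : ℕ) (vs : List (Fin n)) {w d us} (P : Prog n w d us) : Set (c ⊔ ℓ) where
    field
      {D E G H} : ℕ
      T : Segment W D E vs
      σ : Fin d → Fin G → Fin D
      τ : Fin H → Fin E
      represents : ∀ a → evalFrom P a ≈ ∑[ γ < G ] ∑[ η < H ] transfer T (σ a γ) (τ η)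

  singlePass-weaken : ∀ {W W′ vs w d us} {P : Prog n w d us} → W ≤ W′ →
                      SinglePass W vs P → SinglePass W′ vs P
  singlePass-weaken W≤W′ rep = record
    { T = weaken W≤W′ T ; σ = σ ; τ = τ
    ; represents = λ a → trans (represents a)
        (sum-cong-≋ (λ γ → sum-cong-≋ (λ η → sym (transfer-weaken W≤W′ T (σ a γ) (τ η))))) }
    where open SinglePass rep

  singlePass-sink : ∀ {w} vs (o : 1 ≤ w) → SinglePass 1 vs (sink {n} o)
  singlePass-sink vs o = record
    { G = 1 ; H = 1 ; T = identitySeg 1 ℕₚ.≤-refl vs ; σ = λ _ _ → zero ; τ = λ _ → zero
    ; represents = λ { zero → sym (begin
        ∑[ γ < 1 ] ∑[ η < 1 ] transfer (identitySeg 1 ℕₚ.≤-refl vs) zero zero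
          ≈⟨ trans (+-identityʳ _) (+-identityʳ _) ⟩
        transfer (identitySeg 1 ℕₚ.≤-refl vs) zero zero
          ≈⟨ transfer-identitySeg 1 ℕₚ.≤-refl vs zero zero ⟩
        1P ∎) } }

  -- With S the first pass and T representing the
  -- rest, T′ = (identity ⊗ S) ⊗ T; a source of T′ is (guess g, a, a source
  -- of T for g), a sink is (h, h, a sink of T): the identity factor carries
  -- the guessed vertex g across the pass, and δ g h checks it against the
  -- vertex h at which S ends.
  extend : ∀ {w W d i vs us} {P : Prog n w d ((i ∷ vs) ++ us)} (C : Cut (i ∷ vs) us P) →
           SinglePass W (i ∷ vs) (Cut.back C) → SinglePass ((w * w) * W) (i ∷ vs) P
  extend {w} {W} {d} {i} {vs} {P = P} C rep = record
    { T = T′ ; σ = σ′ ; τ = τ′ ; represents = represents′ }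
    where
    open Cut C
    module Q = SinglePass rep

    I : Segment w e e (i ∷ vs)
    I = identitySeg e (lastWidth front) (i ∷ vs)

    T′ : Segment ((w * w) * W) ((e * d) * Q.D) ((e * e) * Q.E) (i ∷ vs)
    T′ = tensor (tensor I front) Q.T

    σ′ : Fin d → Fin (e * Q.G) → Fin ((e * d) * Q.D)
    σ′ a = uncurry (λ g γ → combine (combine g a) (Q.σ g γ)) ∘ remQuot {e} Q.G

    τ′ : Fin (e * Q.H) → Fin ((e * e) * Q.E)
    τ′ = uncurry (λ h η → combine (combine h h) (Q.τ η)) ∘ remQuot {e} Q.H

    X : Fin e → Fin Q.G → Fin Q.H → Poly n
    X g γ η = transfer Q.T (Q.σ g γ) (Q.τ η)

    entry : ∀ a g γ h η → transfer T′ (σ′ a (combine g γ)) (τ′ (combine h η)) ≈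
                          (δ g h *P transfer front a h) *P X g γ η
    entry a g γ h η = begin
      transfer T′ (σ′ a (combine g γ)) (τ′ (combine h η))
        ≡⟨ ≡.cong₂ (transfer T′)
             (≡.cong (uncurry (λ g γ → combine (combine g a) (Q.σ g γ))) (remQuot-combine {k = Q.G} g γ))
             (≡.cong (uncurry (λ h η → combine (combine h h) (Q.τ η))) (remQuot-combine {k = Q.H} h η)) ⟩
      transfer T′ (combine (combine g a) (Q.σ g γ)) (combine (combine h h) (Q.τ η))
        ≈⟨ transfer-tensor (tensor I front) Q.T (combine g a) (Q.σ g γ) (combine h h) (Q.τ η) ⟩
      transfer (tensor I front) (combine g a) (combine h h) *P X g γ η
        ≈⟨ *-congʳ (transfer-tensor I front g a h h) ⟩
      (transfer I g h *P transfer front a h) *P X g γ η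
        ≈⟨ *-congʳ (*-congʳ (transfer-identitySeg e (lastWidth front) (i ∷ vs) g h)) ⟩
      (δ g h *P transfer front a h) *P X g γ η ∎

    represents′ : ∀ a → evalFrom P a ≈
                        ∑[ t < e * Q.G ] ∑[ t′ < e * Q.H ] transfer T′ (σ′ a t) (τ′ t′)
    represents′ a = begin
      evalFrom P a
        ≈⟨ eval a ⟩
      ∑[ g < e ] (transfer front a g *P evalFrom back g)
        ≈⟨ sum-cong-≋ (λ g → *-congˡ (Q.represents g)) ⟩
      ∑[ g < e ] (transfer front a g *P ∑[ γ < Q.G ] ∑[ η < Q.H ] X g γ η)
        ≈⟨ ∑-guess (transfer front a) X ⟨
      ∑[ g < e ] ∑[ γ < Q.G ] ∑[ h < e ] ∑[ η < Q.H ] ((δ g h *P transfer front a h) *P X g γ η)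
        ≈⟨ sum-cong-≋ (λ g → sum-cong-≋ (λ γ → sum-cong-≋ (λ h → sum-cong-≋ (entry a g γ h)))) ⟨
      ∑[ g < e ] ∑[ γ < Q.G ] ∑[ h < e ] ∑[ η < Q.H ] transfer T′ (σ′ a (combine g γ)) (τ′ (combine h η))
        ≈⟨ ∑∑-combine e Q.G e Q.H (λ t t′ → transfer T′ (σ′ a t) (τ′ t′)) ⟨
      ∑[ t < e * Q.G ] ∑[ t′ < e * Q.H ] transfer T′ (σ′ a t) (τ′ t′) ∎

  width-step : ∀ w k → (w * w) * w ^ (2 * k) ≤ w ^ (2 * suc k)
  width-step w k =
    ℕₚ.≤-reflexive (≡.trans (ℕₚ.*-assoc w w _) (≡.cong (w ^_) (≡.sym (ℕₚ.*-suc 2 k))))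

  singlePass : ∀ {w} i vs k {d} (P : Prog n w d (passes k (i ∷ vs))) →
               SinglePass (w ^ (2 * k)) (i ∷ vs) P
  singlePass i vs zero    (sink o) = singlePass-sink (i ∷ vs) o
  singlePass {w} i vs (suc k) P =
    singlePass-weaken (width-step w k) (extend C (singlePass i vs k (Cut.back C)))
    where C = cut (i ∷ vs) P

  progWidth : ∀ {w d vs} → Prog n w d vs → 1 ≤ w
  progWidth (sink o)          = o
  progWidth (layer _ _ _ _ P) = progWidth P

  width^-positive : ∀ {w d vs} → Prog n w d vs → ∀ k → 1 ≤ w ^ (2 * k)
  width^-positive {w} P k = ℕₚ.m^n>0 w {{>-nonZero (progWidth P)}} (2 * k)

  collapse : ∀ {W w i vs us} {P : Prog n w 1 us} → SinglePass W (i ∷ vs) P → 1 ≤ W →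
             Σ (Prog n W 1 (i ∷ vs)) (λ B → evalFrom B zero ≈ evalFrom P zero)
  collapse {W} {P = P} rep o = toProg S o , (begin
    evalFrom (toProg S o) zero
      ≈⟨ evalFrom-toProg S o zero ⟩
    transfer S zero zero
      ≈⟨ transfer-mergeSinks (mergeSources T G (σ zero)) o H τ zero ⟩
    ∑[ η < H ] transfer (mergeSources T G (σ zero)) zero (τ η)
      ≈⟨ sum-cong-≋ (λ η → transfer-mergeSources T G (σ zero) (τ η)) ⟩
    ∑[ η < H ] ∑[ γ < G ] transfer T (σ zero γ) (τ η)
      ≈⟨ ∑-comm (λ η γ → transfer T (σ zero γ) (τ η)) ⟩
    ∑[ γ < G ] ∑[ η < H ] transfer T (σ zero γ) (τ η)
      ≈⟨ represents zero ⟨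
    evalFrom P zero ∎)
    where
    open SinglePass rep
    S : Segment W 1 1 _
    S = mergeSinks (mergeSources T G (σ zero)) o H τ

  evalFrom-passes-[] : ∀ {w} k (A : Prog n w 1 (passes k [])) → 1P ≈ evalFrom A zero
  evalFrom-passes-[] zero    (sink o) = refl
  evalFrom-passes-[] (suc k) A        = evalFrom-passes-[] k A

module _ {c ℓ : Level} (R : CommutativeRing c ℓ) where
  open ABPs R
  open PolynomialSemiring R using (_≃_)

  -- The theorem, over an arbitrary commutative ring.  Without variables the
  -- program computes 1 and the sink alone suffices; otherwise the block
  -- x_{π(1)} … x_{π(n)} is nonempty and the construction applies.
  readOnce : ∀ n k w (π : Permutation′ n) (A : KPassABP n k w π) →
             Σ (ROABP n (w ^ (2 * k)) π) (λ B → output B ≃ output A)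
  readOnce zero    k w π A = sink (width^-positive A k) , evalFrom-passes-[] k A
    where open ReadOnce R 0
  readOnce (suc m) k w π A = collapse (singlePass (π ⟨$⟩ʳ zero) _ k A) (width^-positive A k)
    where open ReadOnce R (suc m)

lemma2p6 : ∀ {c ℓ : Level} (F : Field c ℓ) (n k w : ℕ) (π : Permutation′ n)
             (A : ABPs.KPassABP (Field.commutativeRing F) n k w π) →
             Σ (ABPs.ROABP (Field.commutativeRing F) n (w ^ (2 * k)) π)
               (λ B → ABPs._≈P_ (Field.commutativeRing F)
                        (ABPs.output (Field.commutativeRing F) B)
                        (ABPs.output (Field.commutativeRing F) A))
lemma2p6 F n k w π A =
  map₂ PolynomialSemiring.unwrap (readOnce (Field.commutativeRing F) n k w π A)
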